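{- Let $n$ be a positive integer and $M(n)$ the poset defined below. An element $A\in M(n)$ has palindromic (rank-symmetric) lower interval $[\varnothing,A]$ if and only if $A=\varnothing$, or $A=\{k\}$ for some $1\le k\le n$, or $A=\{1,2,\dots,k\}$ for some $1\le k\le n$.
   Context: $M(n)$ is the set of subsets of $[n]=\{1,\dots,n\}$ with the partial order $\preceq$: for $A=\{a_1<\dots<a_j\}$ and $B=\{b_1<\dots<b_k\}$, $A\preceq B$ iff $j\le k$ and $a_{j-i}\le b_{k-i}$ for every $0\le i\le j-1$. This is a graded poset (rank of $A$ is the sum of its elements); $[\varnothing,A]$ is palindromic if its rank generating function is a palindromic polynomial. -}

module Defs where

open import Data.Bool using (Bool; true; false; if_then_else_)
open import Data.Nat using (ℕ; zero; suc; _+_; _≤_; _∸_; _≤?_; _≟_)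
open import Data.Nat.Properties using (≤-refl)
open import Data.List using (List; []; _∷_; map; _++_; reverse; length; filter)
open import Data.Nat.ListAction using (sum)
open import Data.Vec using (Vec; []; _∷_)
open import Data.Fin.Subset using (Subset)
open import Data.Product using (_×_; _,_)
open import Data.Empty using (⊥)
open import Data.Unit using (⊤; tt)
open import Relation.Nullary using (Dec; yes; no; ¬_)
open import Relation.Nullary.Decidable using (_×-dec_)
open import Relation.Binary.PropositionalEquality using (_≡_)

-- A subset of [n] = {1,…,n} is a 'Subset n' (= Vec Bool n); position i
-- (a 'Fin n', i = 0,…,n-1) stands for the element i+1.

elemsFrom : ∀ {n} → ℕ → Subset n → List ℕ
elemsFrom m []          = []
elemsFrom m (true  ∷ p) = suc m ∷ elemsFrom (suc m) p
elemsFrom m (false ∷ p) = elemsFrom (suc m) p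

elems : ∀ {n} → Subset n → List ℕ
elems = elemsFrom 0

rank : ∀ {n} → Subset n → ℕ
rank A = sum (elems A)

-- Comparison of the decreasing lists (aⱼ, aⱼ₋₁, …, a₁) and (bₖ, …, b₁):
-- j ≤ k and a_{j-i} ≤ b_{k-i} for 0 ≤ i ≤ j-1.
data _⊑_ : List ℕ → List ℕ → Set where
  []⊑  : ∀ {ys} → [] ⊑ ys
  _∷⊑_ : ∀ {x y xs ys} → x ≤ y → xs ⊑ ys → (x ∷ xs) ⊑ (y ∷ ys)

_⪯_ : ∀ {n} → Subset n → Subset n → Set
A ⪯ B = reverse (elems A) ⊑ reverse (elems B)

_⊑?_ : (xs ys : List ℕ) → Dec (xs ⊑ ys)
[] ⊑? ys = yes []⊑
(x ∷ xs) ⊑? [] = no (λ ())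
(x ∷ xs) ⊑? (y ∷ ys) with x ≤? y | xs ⊑? ys
... | yes p | yes q = yes (p ∷⊑ q)
... | no ¬p | _     = no (λ { (p ∷⊑ _) → ¬p p })
... | yes _ | no ¬q = no (λ { (_ ∷⊑ q) → ¬q q })

_⪯?_ : ∀ {n} (A B : Subset n) → Dec (A ⪯ B)
A ⪯? B = reverse (elems A) ⊑? reverse (elems B)

allSubsets : (n : ℕ) → List (Subset n)
allSubsets zero    = [] ∷ []
allSubsets (suc n) = map (true ∷_) (allSubsets n) ++ map (false ∷_) (allSubsets n)

-- Coefficient of qⁱ in the rank generating function of [∅, A]:
-- the number of B ∈ M(n) with B ⪯ A and rank B = i.
-- (Every B ⪯ A automatically satisfies ∅ ⪯ B.)
coeff : ∀ {n} → Subset n → ℕ → ℕ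
coeff {n} A i = length (filter (λ B → (B ⪯? A) ×-dec (rank B ≟ i)) (allSubsets n))

Palindromic : ∀ {n} → Subset n → Set
Palindromic A = ∀ i → i ≤ rank A → coeff A i ≡ coeff A (rank A ∸ i)

oneTo : ℕ → List ℕ
oneTo zero    = []
oneTo (suc k) = oneTo k ++ (suc k ∷ [])

-- The lower intervals of ∅, {k} and [k] are palindromic for transparent reasons: [∅, {k}] is
-- the chain ∅ ≺ {1} ≺ … ≺ {k}, and [∅, [k]] consists of the subsets of [k], on which
-- complementation in [k] reverses the rank.  Every other A has, for d = 1 or d = 2, two
-- distinct elements of rank (rank A − d) below it (obtained by deleting the element 1 or 2,
-- or by moving one or two elements of A down into gaps of A), whereas at most one subset of
-- [n] has rank d.  So the coefficients of q^d and q^(rank A − d) differ.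
module Submission where

open import Defs
open import Function.Bundles using (_⇔_; mk⇔)
open import Function.Base using (_∘_)
open import Data.Bool using (true; false; not)
open import Data.Nat using (ℕ; zero; suc; _+_; _≤_; _<_; _∸_; z≤n; s≤s; _≟_)
open import Data.Nat.Properties
open import Data.Nat.ListAction using (sum)
open import Data.List using (List; []; _∷_; _++_; _∷ʳ_; [_]; reverse; length; filter; map)
open import Data.List.Properties
  using (unfold-reverse; reverse-++; reverse-injective; length-reverse; length-++; length-filter;
         filter-++; filter-≐; filter-none; filter-some)
import Data.List.Properties as List
open import Data.List.Relation.Unary.All as All using (All; []; _∷_)
open import Data.List.Relation.Unary.All.Properties using (++⁺)
open import Data.List.Relation.Unary.Any using (here; there; any?; satisfied)
open import Data.List.Membership.Propositional using (_∈_; lose)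
open import Data.List.Membership.Propositional.Properties using (∈-map⁺; ∈-++⁺ˡ; ∈-++⁺ʳ; ∈-filter⁺)
open import Data.Vec using (_∷_; [])
import Data.Vec.Properties as Vec
open import Data.Fin using (Fin; toℕ; fromℕ<)
open import Data.Fin.Properties using (toℕ-fromℕ<)
open import Data.Fin.Subset using (Subset; ⊥; ⁅_⁆)
open import Data.Product using (Σ-syntax; _×_; _,_; proj₁; proj₂)
open import Data.Sum using (_⊎_; inj₁; inj₂)
open import Data.Unit using (⊤; tt)
open import Data.Empty using (⊥-elim)
open import Relation.Nullary using (yes; no; ¬_; does; contradiction)
open import Relation.Nullary.Decidable using (_×-dec_)
open import Relation.Unary using (Pred; Decidable; _≐_)
open import Level using (0ℓ)
open import Relation.Binary.PropositionalEquality hiding ([_])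

private
  variable
    n m : ℕ
    xs ys zs : List ℕ

⊑-refl : ∀ xs → xs ⊑ xs
⊑-refl []       = []⊑
⊑-refl (x ∷ xs) = ≤-refl ∷⊑ ⊑-refl xs

⊑-[] : xs ⊑ [] → xs ≡ []
⊑-[] []⊑ = refl

⊑-length : xs ⊑ ys → length xs ≤ length ys
⊑-length []⊑      = z≤n
⊑-length (_ ∷⊑ p) = s≤s (⊑-length p)

⊑-++ʳ : ∀ zs → xs ⊑ ys → xs ⊑ (ys ++ zs)
⊑-++ʳ zs []⊑      = []⊑
⊑-++ʳ zs (x≤y ∷⊑ p) = x≤y ∷⊑ ⊑-++ʳ zs p

⊑-++ˡ : ∀ xs → ys ⊑ zs → (xs ++ ys) ⊑ (xs ++ zs)
⊑-++ˡ []       p = p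
⊑-++ˡ (x ∷ xs) p = ≤-refl ∷⊑ ⊑-++ˡ xs p

++-⊑⁻ : ∀ xs → (xs ++ zs) ⊑ ys → xs ⊑ ys
++-⊑⁻ []       _            = []⊑
++-⊑⁻ (x ∷ xs) (x≤y ∷⊑ p) = x≤y ∷⊑ ++-⊑⁻ xs p

⊑-∷ʳ : ∀ {x} → xs ⊑ ys → All (x ≤_) ys → (xs ∷ʳ x) ⊑ (ys ∷ʳ x)
⊑-∷ʳ {ys = []}    []⊑ []         = ≤-refl ∷⊑ []⊑
⊑-∷ʳ {ys = _ ∷ _} []⊑ (x≤y ∷ _) = x≤y ∷⊑ []⊑
⊑-∷ʳ (p ∷⊑ q) (_ ∷ x≤ys)         = p ∷⊑ ⊑-∷ʳ q x≤ys

⊑-∷ʳ⁻ : ∀ ys {y} → xs ⊑ (ys ∷ʳ y) → All (y <_) xs → xs ⊑ ys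
⊑-∷ʳ⁻ []       []⊑            _          = []⊑
⊑-∷ʳ⁻ []       (x≤y ∷⊑ []⊑)   (y<x ∷ _)  = ⊥-elim (<⇒≱ y<x x≤y)
⊑-∷ʳ⁻ (_ ∷ ys) []⊑            _          = []⊑
⊑-∷ʳ⁻ (_ ∷ ys) (x≤y ∷⊑ p)     (_ ∷ y<xs) = x≤y ∷⊑ ⊑-∷ʳ⁻ ys p y<xs

⊑-reverse-++ : ∀ xs ys zs → reverse xs ⊑ reverse ys → reverse (xs ++ zs) ⊑ reverse (ys ++ zs)
⊑-reverse-++ xs ys zs p rewrite reverse-++ xs zs | reverse-++ ys zs = ⊑-++ˡ (reverse zs) p

All-reverse : ∀ {P : ℕ → Set} → All P xs → All P (reverse xs)
All-reverse {xs = []}     []       = []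
All-reverse {xs = x ∷ xs} (p ∷ ps) rewrite unfold-reverse x xs = ++⁺ (All-reverse ps) (p ∷ [])

⊑-reverse-∷ : ∀ {x} xs ys → reverse xs ⊑ reverse ys → All (x ≤_) ys → reverse (x ∷ xs) ⊑ reverse (x ∷ ys)
⊑-reverse-∷ {x} xs ys p x≤ys rewrite unfold-reverse x xs | unfold-reverse x ys = ⊑-∷ʳ p (All-reverse x≤ys)

⊑-reverse-∷⁻ : ∀ {x} xs ys → reverse (x ∷ xs) ⊑ reverse (x ∷ ys) → All (x <_) xs → reverse xs ⊑ reverse ys
⊑-reverse-∷⁻ {x} xs ys p x<xs rewrite unfold-reverse x xs | unfold-reverse x ys =
  ⊑-∷ʳ⁻ (reverse ys) (++-⊑⁻ (reverse xs) p) (All-reverse x<xs)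

⊑-reverse-∷ʳ : ∀ {y} xs ys → reverse xs ⊑ reverse ys → reverse xs ⊑ reverse (y ∷ ys)
⊑-reverse-∷ʳ {y} xs ys p rewrite unfold-reverse y ys = ⊑-++ʳ [ y ] p

⊑-reverse-∷ʳ⁻ : ∀ {y} xs ys → reverse xs ⊑ reverse (y ∷ ys) → All (y <_) xs → reverse xs ⊑ reverse ys
⊑-reverse-∷ʳ⁻ {y} xs ys p y<xs rewrite unfold-reverse y ys = ⊑-∷ʳ⁻ (reverse ys) p (All-reverse y<xs)

m+n≡o⇒n≡o∸m : ∀ {m n o} → m + n ≡ o → n ≡ o ∸ m
m+n≡o⇒n≡o∸m {m} {n} refl = sym (m+n∸m≡n m n)

m+n≡o⇒m≡o∸n : ∀ {m n o} → m + n ≡ o → m ≡ o ∸ n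
m+n≡o⇒m≡o∸n {m} {n} refl = sym (m+n∸n≡m m n)

distinct-∈⇒2≤length : ∀ {A : Set} {x y : A} {zs} → x ∈ zs → y ∈ zs → x ≢ y → 2 ≤ length zs
distinct-∈⇒2≤length (here refl)              (here refl)              x≢y = ⊥-elim (x≢y refl)
distinct-∈⇒2≤length (here refl)              (there {xs = _ ∷ _} _)   _   = s≤s (s≤s z≤n)
distinct-∈⇒2≤length (there {xs = _ ∷ _} _)   (here refl)              _   = s≤s (s≤s z≤n)
distinct-∈⇒2≤length (there p)                (there q)                x≢y = m≤n⇒m≤1+n (distinct-∈⇒2≤length p q x≢y)

sum-injective-≤1 : length xs ≤ 1 → length ys ≤ 1 → All (0 <_) xs → All (0 <_) ys → sum xs ≡ sum ys → xs ≡ ys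
sum-injective-≤1 {[]}          {[]}          _        _        _          _          _ = refl
sum-injective-≤1 {x ∷ []}      {y ∷ []}      _        _        _          _          s =
  cong [_] (trans (sym (+-identityʳ x)) (trans s (+-identityʳ y)))
sum-injective-≤1 {[]}          {y ∷ []}      _        _        _          (0<y ∷ []) s =
  ⊥-elim (<⇒≢ 0<y (trans s (+-identityʳ y)))
sum-injective-≤1 {x ∷ []}      {[]}          _        _        (0<x ∷ []) _          s =
  ⊥-elim (<⇒≢ 0<x (sym (trans (sym (+-identityʳ x)) s)))
sum-injective-≤1 {_ ∷ _ ∷ _}   {_}           (s≤s ()) _        _          _          _
sum-injective-≤1 {_}           {_ ∷ _ ∷ _}   _        (s≤s ()) _          _          _

rankFrom : ℕ → Subset n → ℕ
rankFrom m B = sum (elemsFrom m B)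

elemsFrom-bounded : ∀ m (B : Subset n) → All (λ x → m < x × x ≤ m + n) (elemsFrom m B)
elemsFrom-bounded m []            = []
elemsFrom-bounded {suc n} m (b ∷ B) = bounded b
  where
    shift : ∀ {x} → suc m < x × x ≤ suc m + n → m < x × x ≤ m + suc n
    shift {x} (lo , hi) = <-trans (n<1+n m) lo , subst (x ≤_) (sym (+-suc m n)) hi
    bounded : ∀ b → All (λ x → m < x × x ≤ m + suc n) (elemsFrom m (b ∷ B))
    bounded true  = (≤-refl , m<m+n m (s≤s z≤n)) ∷ All.map shift (elemsFrom-bounded (suc m) B)
    bounded false = All.map shift (elemsFrom-bounded (suc m) B)

elemsFrom-> : ∀ m (B : Subset n) → All (m <_) (elemsFrom m B)
elemsFrom-> m B = All.map proj₁ (elemsFrom-bounded m B)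

elemsFrom-head : ∀ m (B : Subset n) → elemsFrom (suc m) B ≢ suc m ∷ xs
elemsFrom-head m B e with subst (All (suc m <_)) e (elemsFrom-> (suc m) B)
... | m<m ∷ _ = <-irrefl refl m<m

elemsFrom-⊥ : ∀ m → elemsFrom m (⊥ {n}) ≡ []
elemsFrom-⊥ {zero}  m = refl
elemsFrom-⊥ {suc n} m = elemsFrom-⊥ {n} (suc m)

elemsFrom≡[]⇒⊥ : ∀ m (B : Subset n) → elemsFrom m B ≡ [] → B ≡ ⊥
elemsFrom≡[]⇒⊥ m []          _ = refl
elemsFrom≡[]⇒⊥ m (false ∷ B) e = cong (false ∷_) (elemsFrom≡[]⇒⊥ (suc m) B e)

elemsFrom-injective : ∀ m (B C : Subset n) → elemsFrom m B ≡ elemsFrom m C → B ≡ C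
elemsFrom-injective m []          []          _ = refl
elemsFrom-injective m (true ∷ B)  (true ∷ C)  e =
  cong (true ∷_) (elemsFrom-injective (suc m) B C (List.∷-injectiveʳ e))
elemsFrom-injective m (false ∷ B) (false ∷ C) e = cong (false ∷_) (elemsFrom-injective (suc m) B C e)
elemsFrom-injective m (true ∷ B)  (false ∷ C) e = ⊥-elim (elemsFrom-head m C (sym e))
elemsFrom-injective m (false ∷ B) (true ∷ C)  e = ⊥-elim (elemsFrom-head m B e)

elemsFrom-⁅⁆ : ∀ m (i : Fin n) → elemsFrom m ⁅ i ⁆ ≡ [ suc (toℕ i + m) ]
elemsFrom-⁅⁆ {suc n} m Fin.zero    = cong (suc m ∷_) (elemsFrom-⊥ {n} (suc m))
elemsFrom-⁅⁆         m (Fin.suc i) = trans (elemsFrom-⁅⁆ (suc m) i) (cong (λ x → [ suc x ]) (+-suc (toℕ i) m))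

rankFrom-nonempty : ∀ m (B : Subset n) → 1 ≤ length (elemsFrom m B) → suc m ≤ rankFrom m B
rankFrom-nonempty m (true ∷ B)  _ = m≤m+n (suc m) _
rankFrom-nonempty m (false ∷ B) p = <⇒≤ (rankFrom-nonempty (suc m) B p)

rankFrom-two : ∀ m (B : Subset n) → 2 ≤ length (elemsFrom m B) → 3 ≤ rankFrom m B
rankFrom-two m (true ∷ B)  (s≤s p) = +-mono-≤ (s≤s (z≤n {m})) (≤-trans (s≤s (s≤s z≤n)) (rankFrom-nonempty (suc m) B p))
rankFrom-two m (false ∷ B) p       = rankFrom-two (suc m) B p

rank-injective-≤1 : ∀ (B C : Subset n) → length (elems B) ≤ 1 → length (elems C) ≤ 1 →
                    rank B ≡ rank C → B ≡ C
rank-injective-≤1 B C lB lC r =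
  elemsFrom-injective 0 B C (sum-injective-≤1 lB lC (elemsFrom-> 0 B) (elemsFrom-> 0 C) r)

rank-injective-≤2 : ∀ (B C : Subset n) → rank B ≡ rank C → rank B ≤ 2 → B ≡ C
rank-injective-≤2 B C r r≤2 = rank-injective-≤1 B C (short B r≤2) (short C (subst (_≤ 2) r r≤2)) r
  where
    short : ∀ (D : Subset n) → rank D ≤ 2 → length (elems D) ≤ 1
    short D r≤2 = ≮⇒≥ (λ 2≤l → <⇒≱ (s≤s r≤2) (rankFrom-two 0 D 2≤l))

-- B ⪯ A is ⊑-reversed of B ≼[ 0 ] A; a record rather than a definition, so that B and A
-- can be inferred.
record _≼[_]_ (B : Subset n) (m : ℕ) (A : Subset n) : Set where
  constructor ≼-intro
  field ⊑-reversed : reverse (elemsFrom m B) ⊑ reverse (elemsFrom m A)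

open _≼[_]_

≼-refl : ∀ {B : Subset n} → B ≼[ m ] B
≼-refl = ≼-intro (⊑-refl _)

≼-false : ∀ {B A : Subset n} → B ≼[ suc m ] A → (false ∷ B) ≼[ m ] (false ∷ A)
≼-false w = ≼-intro (⊑-reversed w)

≼-true : ∀ {B A : Subset n} → B ≼[ suc m ] A → (true ∷ B) ≼[ m ] (true ∷ A)
≼-true {m = m} {B} {A} (≼-intro w) =
  ≼-intro (⊑-reverse-∷ (elemsFrom (suc m) B) (elemsFrom (suc m) A) w (All.map <⇒≤ (elemsFrom-> (suc m) A)))

≼-true⁻ : ∀ {B A : Subset n} → (true ∷ B) ≼[ m ] (true ∷ A) → B ≼[ suc m ] A
≼-true⁻ {m = m} {B} {A} (≼-intro w) =
  ≼-intro (⊑-reverse-∷⁻ (elemsFrom (suc m) B) (elemsFrom (suc m) A) w (elemsFrom-> (suc m) B))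

≼-false-true : ∀ {B A : Subset n} → B ≼[ suc m ] A → (false ∷ B) ≼[ m ] (true ∷ A)
≼-false-true {m = m} {B} {A} (≼-intro w) = ≼-intro (⊑-reverse-∷ʳ (elemsFrom (suc m) B) (elemsFrom (suc m) A) w)

≼-false-true⁻ : ∀ {B A : Subset n} → (false ∷ B) ≼[ m ] (true ∷ A) → B ≼[ suc m ] A
≼-false-true⁻ {m = m} {B} {A} (≼-intro w) =
  ≼-intro (⊑-reverse-∷ʳ⁻ (elemsFrom (suc m) B) (elemsFrom (suc m) A) w (elemsFrom-> (suc m) B))

≼-delete-first : ∀ {R : Subset n} → (false ∷ R) ≼[ m ] (true ∷ R)
≼-delete-first = ≼-false-true ≼-refl

≼-jump : ∀ m (R : Subset n) → (true ∷ false ∷ false ∷ R) ≼[ m ] (false ∷ false ∷ true ∷ R)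
≼-jump m R = ≼-intro (⊑-reverse-++ [ suc m ] [ 3 + m ] (elemsFrom (3 + m) R) (m≤n+m _ 2 ∷⊑ []⊑))

≼-shift-pair : ∀ m (R : Subset n) → (true ∷ true ∷ false ∷ R) ≼[ m ] (false ∷ true ∷ true ∷ R)
≼-shift-pair m R =
  ≼-intro (⊑-reverse-++ (suc m ∷ [ 2 + m ]) (2 + m ∷ [ 3 + m ]) (elemsFrom (3 + m) R) (n≤1+n _ ∷⊑ (n≤1+n _ ∷⊑ []⊑)))

-- Moving an element down into a gap

data Gap : Subset n → Set where
  here  : ∀ {R : Subset n} → Gap (false ∷ true ∷ R)
  there : ∀ {b} {A : Subset n} → Gap A → Gap (b ∷ A)

lower : {A : Subset n} → Gap A → Subset n
lower (here {R = R})     = true ∷ false ∷ R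
lower (there {b = b} g) = b ∷ lower g

lower-≼ : ∀ m {A : Subset n} (g : Gap A) → lower g ≼[ m ] A
lower-≼ m (here {R = R})       = ≼-intro (⊑-reverse-++ [ suc m ] [ 2 + m ] (elemsFrom (2 + m) R) (n≤1+n _ ∷⊑ []⊑))
lower-≼ m (there {b = true} g)  = ≼-true (lower-≼ (suc m) g)
lower-≼ m (there {b = false} g) = ≼-false (lower-≼ (suc m) g)

rankFrom-lower : ∀ m {A : Subset n} (g : Gap A) → rankFrom m A ≡ suc (rankFrom m (lower g))
rankFrom-lower m here                  = refl
rankFrom-lower m (there {b = true} g)  = trans (cong (suc m +_) (rankFrom-lower (suc m) g)) (+-suc (suc m) _)
rankFrom-lower m (there {b = false} g) = rankFrom-lower (suc m) g

consecutive : ℕ → ℕ → List ℕ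
consecutive m zero    = []
consecutive m (suc k) = suc m ∷ consecutive (suc m) k

consecutive-∷ʳ : ∀ m k → consecutive m (suc k) ≡ consecutive m k ∷ʳ suc (m + k)
consecutive-∷ʳ m zero    = cong (λ x → [ suc x ]) (sym (+-identityʳ m))
consecutive-∷ʳ m (suc k) =
  cong (suc m ∷_) (trans (consecutive-∷ʳ (suc m) k) (cong (λ x → consecutive (suc m) k ∷ʳ suc x) (sym (+-suc m k))))

oneTo≡consecutive : ∀ k → oneTo k ≡ consecutive 0 k
oneTo≡consecutive zero    = refl
oneTo≡consecutive (suc k) = trans (cong (_∷ʳ suc k) (oneTo≡consecutive k)) (sym (consecutive-∷ʳ 0 k))

gap-or-empty : ∀ m (A : Subset n) → Gap (false ∷ A) ⊎ elemsFrom m (false ∷ A) ≡ []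
gap-or-empty m []          = inj₂ refl
gap-or-empty m (true ∷ A)  = inj₁ here
gap-or-empty m (false ∷ A) with gap-or-empty (suc m) A
... | inj₁ g = inj₁ (there g)
... | inj₂ e = inj₂ e

gap-or-consecutive : ∀ m (A : Subset n) → Gap A ⊎ Σ[ q ∈ ℕ ] (q ≤ n × elemsFrom m A ≡ consecutive m q)
gap-or-consecutive m []          = inj₂ (0 , z≤n , refl)
gap-or-consecutive m (true ∷ A)  with gap-or-consecutive (suc m) A
... | inj₁ g               = inj₁ (there g)
... | inj₂ (q , q≤n , e)   = inj₂ (suc q , s≤s q≤n , cong (suc m ∷_) e)
gap-or-consecutive m (false ∷ A) with gap-or-empty m A
... | inj₁ g = inj₁ g
... | inj₂ e = inj₂ (0 , z≤n , e)

-- Counting subsets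

countSubsets : {P : Pred (Subset n) 0ℓ} → Decidable P → ℕ
countSubsets {n} P? = length (filter P? (allSubsets n))

∈-allSubsets : (B : Subset n) → B ∈ allSubsets n
∈-allSubsets []          = here refl
∈-allSubsets (true ∷ B)  = ∈-++⁺ˡ (∈-map⁺ (true ∷_) (∈-allSubsets B))
∈-allSubsets (false ∷ B) = ∈-++⁺ʳ (map (true ∷_) (allSubsets _)) (∈-map⁺ (false ∷_) (∈-allSubsets B))

length-filter-map : ∀ {A B : Set} {P : Pred B 0ℓ} (P? : Decidable P) (g : A → B) xs →
                    length (filter P? (map g xs)) ≡ length (filter (P? ∘ g) xs)
length-filter-map P? g []       = refl
length-filter-map P? g (x ∷ xs) with does (P? (g x))
... | true  = cong suc (length-filter-map P? g xs)
... | false = length-filter-map P? g xs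

countSubsets-∷ : {P : Pred (Subset (suc n)) 0ℓ} (P? : Decidable P) →
                 countSubsets P? ≡ countSubsets (P? ∘ (true ∷_)) + countSubsets (P? ∘ (false ∷_))
countSubsets-∷ {n} P? = begin
  length (filter P? (ts ++ fs))                        ≡⟨ cong length (filter-++ P? ts fs) ⟩
  length (filter P? ts ++ filter P? fs)                ≡⟨ length-++ (filter P? ts) ⟩
  length (filter P? ts) + length (filter P? fs)        ≡⟨ cong₂ _+_ (length-filter-map P? (true ∷_) (allSubsets n))
                                                                    (length-filter-map P? (false ∷_) (allSubsets n)) ⟩
  countSubsets (P? ∘ (true ∷_)) + countSubsets (P? ∘ (false ∷_)) ∎
  where
    open ≡-Reasoning
    ts = map (true ∷_) (allSubsets n)
    fs = map (false ∷_) (allSubsets n)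

countSubsets-≐ : {P Q : Pred (Subset n) 0ℓ} (P? : Decidable P) (Q? : Decidable Q) →
                 P ≐ Q → countSubsets P? ≡ countSubsets Q?
countSubsets-≐ {n} P? Q? P≐Q = cong length (filter-≐ P? Q? P≐Q (allSubsets n))

countSubsets-≥1 : {P : Pred (Subset n) 0ℓ} (P? : Decidable P) {B : Subset n} → P B → 1 ≤ countSubsets P?
countSubsets-≥1 P? {B} pB = filter-some P? (lose (∈-allSubsets B) pB)

countSubsets-≥2 : {P : Pred (Subset n) 0ℓ} (P? : Decidable P) {B C : Subset n} →
                  P B → P C → B ≢ C → 2 ≤ countSubsets P?
countSubsets-≥2 P? {B} {C} pB pC =
  distinct-∈⇒2≤length (∈-filter⁺ P? (∈-allSubsets B) pB) (∈-filter⁺ P? (∈-allSubsets C) pC)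

countSubsets-none : {P : Pred (Subset n) 0ℓ} (P? : Decidable P) → (∀ B → ¬ P B) → countSubsets P? ≡ 0
countSubsets-none {n} P? ¬P = cong length (filter-none P? (All.universal ¬P (allSubsets n)))

countSubsets-≤1 : {P : Pred (Subset n) 0ℓ} (P? : Decidable P) →
                  (∀ {B C} → P B → P C → B ≡ C) → countSubsets P? ≤ 1
countSubsets-≤1 {zero}  P? _ = length-filter P? ([] ∷ [])
countSubsets-≤1 {suc n} P? unique rewrite countSubsets-∷ P?
  with any? (P? ∘ (true ∷_)) (allSubsets n)
... | yes some
  rewrite countSubsets-none (P? ∘ (false ∷_)) (λ C pC → contradiction (unique (proj₂ (satisfied some)) pC) λ ())
        | +-identityʳ (countSubsets (P? ∘ (true ∷_)))
  = countSubsets-≤1 (P? ∘ (true ∷_)) (λ pB pC → Vec.∷-injectiveʳ (unique pB pC))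
... | no none
  rewrite countSubsets-none (P? ∘ (true ∷_)) (λ B pB → none (lose (∈-allSubsets B) pB))
  = countSubsets-≤1 (P? ∘ (false ∷_)) (λ pB pC → Vec.∷-injectiveʳ (unique pB pC))

flipFirst : ℕ → Subset n → Subset n
flipFirst zero    B       = B
flipFirst (suc k) []      = []
flipFirst (suc k) (b ∷ B) = not b ∷ flipFirst k B

countSubsets-flipFirst : {P : Pred (Subset n) 0ℓ} (P? : Decidable P) (k : ℕ) →
                         countSubsets P? ≡ countSubsets (P? ∘ flipFirst k)
countSubsets-flipFirst P? zero = refl
countSubsets-flipFirst {zero} P? (suc k) =
  countSubsets-≐ P? (P? ∘ flipFirst (suc k)) ((λ { {[]} p → p }) , (λ { {[]} p → p }))
countSubsets-flipFirst {suc n} P? (suc k) = begin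
  countSubsets P?                                                    ≡⟨ countSubsets-∷ P? ⟩
  countSubsets (P? ∘ (true ∷_)) + countSubsets (P? ∘ (false ∷_))     ≡⟨ +-comm (countSubsets (P? ∘ (true ∷_))) _ ⟩
  countSubsets (P? ∘ (false ∷_)) + countSubsets (P? ∘ (true ∷_))     ≡⟨ cong₂ _+_ (countSubsets-flipFirst (P? ∘ (false ∷_)) k)
                                                                                  (countSubsets-flipFirst (P? ∘ (true ∷_)) k) ⟩
  countSubsets (P? ∘ flipFirst (suc k) ∘ (true ∷_)) + countSubsets (P? ∘ flipFirst (suc k) ∘ (false ∷_))
                                                                     ≡⟨ countSubsets-∷ (P? ∘ flipFirst (suc k)) ⟨
  countSubsets (P? ∘ flipFirst (suc k))                              ∎
  where open ≡-Reasoning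

-- The palindromic intervals

BelowOfRank? : (A : Subset n) (i : ℕ) → Decidable (λ B → (B ⪯ A) × (rank B ≡ i))
BelowOfRank? A i B = (B ⪯? A) ×-dec (rank B ≟ i)

palindromic-empty : (A : Subset n) → elems A ≡ [] → Palindromic A
palindromic-empty A e i i≤r with n≤0⇒n≡0 (subst (i ≤_) (cong sum e) i≤r)
... | refl = cong (coeff A) (sym (cong sum e))

elems-⁅fromℕ<⁆ : ∀ {j} (j<n : j < n) → elems ⁅ fromℕ< j<n ⁆ ≡ [ suc j ]
elems-⁅fromℕ<⁆ j<n = trans (elemsFrom-⁅⁆ 0 _) (cong (λ x → [ suc x ]) (trans (+-identityʳ _) (toℕ-fromℕ< j<n)))

module _ (A : Subset n) {k} (elems-A : elems A ≡ [ k ]) where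

  rank-singleton : rank A ≡ k
  rank-singleton = trans (cong sum elems-A) (+-identityʳ k)

  length-below-singleton : ∀ B → B ⪯ A → length (elems B) ≤ 1
  length-below-singleton B w = subst (_≤ 1) (length-reverse (elems B))
    (⊑-length (subst (λ xs → reverse (elems B) ⊑ reverse xs) elems-A w))

  below-singleton-of-rank : k ≤ n → ∀ i → i ≤ k → Σ[ B ∈ Subset n ] ((B ⪯ A) × (rank B ≡ i))
  below-singleton-of-rank _ zero _ =
    ⊥ , subst (λ xs → reverse xs ⊑ reverse (elems A)) (sym (elemsFrom-⊥ {n} 0)) []⊑ , cong sum (elemsFrom-⊥ {n} 0)
  below-singleton-of-rank k≤n (suc j) j<k =
    ⁅ fromℕ< j<n ⁆ , subst₂ (λ xs ys → reverse xs ⊑ reverse ys) (sym (elems-⁅fromℕ<⁆ j<n)) (sym elems-A) (j<k ∷⊑ []⊑)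
                   , trans (cong sum (elems-⁅fromℕ<⁆ j<n)) (+-identityʳ (suc j))
    where j<n = ≤-trans j<k k≤n

  coeff-singleton : k ≤ n → ∀ i → i ≤ k → coeff A i ≡ 1
  coeff-singleton k≤n i i≤k with below-singleton-of-rank k≤n i i≤k
  ... | B , pB = ≤-antisym
    (countSubsets-≤1 (BelowOfRank? A i) λ {B} {C} (wB , rB) (wC , rC) →
      rank-injective-≤1 B C (length-below-singleton B wB) (length-below-singleton C wC) (trans rB (sym rC)))
    (countSubsets-≥1 (BelowOfRank? A i) {B} pB)

  palindromic-singleton : k ≤ n → Palindromic A
  palindromic-singleton k≤n i i≤r rewrite rank-singleton =
    trans (coeff-singleton k≤n i i≤r) (sym (coeff-singleton k≤n (k ∸ i) (m∸n≤m k i)))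

segment : ℕ → Subset n
segment         zero    = ⊥
segment {zero}  (suc k) = []
segment {suc n} (suc k) = true ∷ segment k

consecutive⇒segment : ∀ m k (A : Subset n) → elemsFrom m A ≡ consecutive m k → A ≡ segment k
consecutive⇒segment m zero    A           e = elemsFrom≡[]⇒⊥ m A e
consecutive⇒segment m (suc k) (true ∷ A)  e =
  cong (true ∷_) (consecutive⇒segment (suc m) k A (List.∷-injectiveʳ e))
consecutive⇒segment m (suc k) (false ∷ A) e = ⊥-elim (elemsFrom-head m A e)

-- B ⊆ [k], in the bit-vector encoding.
Within : ℕ → Subset n → Set
Within zero    B       = B ≡ ⊥
Within (suc k) []      = ⊤
Within (suc k) (_ ∷ B) = Within k B

within⇒≼segment : ∀ m k (B : Subset n) → Within k B → B ≼[ m ] segment k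
within⇒≼segment m zero    B           refl = ≼-refl
within⇒≼segment m (suc k) []          _    = ≼-intro []⊑
within⇒≼segment m (suc k) (true ∷ B)  w    = ≼-true (within⇒≼segment (suc m) k B w)
within⇒≼segment m (suc k) (false ∷ B) w    = ≼-false-true (within⇒≼segment (suc m) k B w)

≼segment⇒within : ∀ m k (B : Subset n) → B ≼[ m ] segment k → Within k B
≼segment⇒within {n} m zero B (≼-intro w) rewrite elemsFrom-⊥ {n} m =
  elemsFrom≡[]⇒⊥ m B (reverse-injective (⊑-[] w))
≼segment⇒within m (suc k) []          _ = tt
≼segment⇒within m (suc k) (true ∷ B)  w = ≼segment⇒within (suc m) k B (≼-true⁻ w)
≼segment⇒within m (suc k) (false ∷ B) w = ≼segment⇒within (suc m) k B (≼-false-true⁻ w)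

within-flipFirst : ∀ k (B : Subset n) → Within k B → Within k (flipFirst k B)
within-flipFirst zero    B       w = w
within-flipFirst (suc k) []      w = w
within-flipFirst (suc k) (_ ∷ B) w = within-flipFirst k B w

within-flipFirst⁻ : ∀ k (B : Subset n) → Within k (flipFirst k B) → Within k B
within-flipFirst⁻ zero    B       w = w
within-flipFirst⁻ (suc k) []      w = w
within-flipFirst⁻ (suc k) (_ ∷ B) w = within-flipFirst⁻ k B w

rankFrom-⊥ : ∀ m → rankFrom m (⊥ {n}) ≡ 0
rankFrom-⊥ {n} m = cong sum (elemsFrom-⊥ {n} m)

rankFrom-flipFirst : ∀ m k (B : Subset n) → Within k B →
                     rankFrom m (flipFirst k B) + rankFrom m B ≡ rankFrom m (segment {n} k)
rankFrom-flipFirst {n} m zero B refl rewrite rankFrom-⊥ {n} m = refl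
rankFrom-flipFirst m (suc k) []          _ = refl
rankFrom-flipFirst m (suc k) (true ∷ B)  w = begin
  x + (suc m + y)  ≡⟨ +-assoc x (suc m) y ⟨
  x + suc m + y    ≡⟨ cong (_+ y) (+-comm x (suc m)) ⟩
  suc m + x + y    ≡⟨ +-assoc (suc m) x y ⟩
  suc m + (x + y)  ≡⟨ cong (suc m +_) (rankFrom-flipFirst (suc m) k B w) ⟩
  _                ∎
  where
    open ≡-Reasoning
    x = rankFrom (suc m) (flipFirst k B)
    y = rankFrom (suc m) B
rankFrom-flipFirst m (suc k) (false ∷ B) w =
  trans (+-assoc (suc m) _ _) (cong (suc m +_) (rankFrom-flipFirst (suc m) k B w))

-- Complementation inside [k] maps the elements of rank i below [k] onto those of rank (rank [k] − i).
palindromic-segment : ∀ k → Palindromic (segment {n} k)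
palindromic-segment {n} k i i≤T =
  trans (countSubsets-flipFirst (BelowOfRank? S i) k)
        (countSubsets-≐ (BelowOfRank? S i ∘ flipFirst k) (BelowOfRank? S (T ∸ i)) (to , from))
  where
    S = segment {n} k
    T = rank S
    within : ∀ {B} → B ⪯ S → Within k B
    within {B} w = ≼segment⇒within 0 k B (≼-intro w)
    below : ∀ {B} → Within k B → B ⪯ S
    below {B} w = ⊑-reversed (within⇒≼segment 0 k B w)
    to : ∀ {B} → (flipFirst k B ⪯ S) × (rank (flipFirst k B) ≡ i) → (B ⪯ S) × (rank B ≡ T ∸ i)
    to {B} (w , refl) = below wB , m+n≡o⇒n≡o∸m (rankFrom-flipFirst 0 k B wB)
      where wB = within-flipFirst⁻ k B (within w)
    from : ∀ {B} → (B ⪯ S) × (rank B ≡ T ∸ i) → (flipFirst k B ⪯ S) × (rank (flipFirst k B) ≡ i)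
    from {B} (w , r) = below (within-flipFirst k B (within w)) , (begin
      rank (flipFirst k B) ≡⟨ m+n≡o⇒m≡o∸n (rankFrom-flipFirst 0 k B (within w)) ⟩
      T ∸ rank B           ≡⟨ cong (T ∸_) r ⟩
      T ∸ (T ∸ i)          ≡⟨ m∸[m∸n]≡n i≤T ⟩
      i                    ∎)
      where open ≡-Reasoning

palindromic-oneTo : (A : Subset n) (k : ℕ) → elems A ≡ oneTo k → Palindromic A
palindromic-oneTo A k e =
  subst Palindromic (sym (consecutive⇒segment 0 k A (trans e (oneTo≡consecutive k)))) (palindromic-segment k)

-- The non-palindromic intervals

record Asymmetry (m : ℕ) (A : Subset n) : Set where
  constructor asymmetry
  field
    d          : ℕ
    d≤2        : d ≤ 2
    B₁ B₂      : Subset n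
    B₁≢B₂      : B₁ ≢ B₂
    B₁≼A       : B₁ ≼[ m ] A
    B₂≼A       : B₂ ≼[ m ] A
    rank-B₁    : rankFrom m A ≡ d + rankFrom m B₁
    rank-B₂    : rankFrom m A ≡ d + rankFrom m B₂

asymmetry-false : ∀ {A : Subset n} → Asymmetry (suc m) A → Asymmetry m (false ∷ A)
asymmetry-false (asymmetry d d≤2 B₁ B₂ B₁≢B₂ B₁≼A B₂≼A r₁ r₂) =
  asymmetry d d≤2 (false ∷ B₁) (false ∷ B₂) (B₁≢B₂ ∘ Vec.∷-injectiveʳ) (≼-false B₁≼A) (≼-false B₂≼A) r₁ r₂

asymmetry-true-gap : ∀ {A : Subset n} → Gap A → Asymmetry 0 (true ∷ A)
asymmetry-true-gap {A = A} g =
  asymmetry 1 (s≤s z≤n) (false ∷ A) (true ∷ lower g) (λ ()) ≼-delete-first (≼-true (lower-≼ 1 g))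
    refl (cong suc (rankFrom-lower 1 g))

asymmetry-gap-gap : ∀ {R : Subset n} → Gap R → Asymmetry m (false ∷ true ∷ R)
asymmetry-gap-gap {m = m} {R = R} g =
  asymmetry 1 (s≤s z≤n) (lower first) (lower second) (λ ())
    (lower-≼ m first) (lower-≼ m second) (rankFrom-lower m first) (rankFrom-lower m second)
  where
    first  = here {R = R}
    second = there {b = false} (there {b = true} g)

asymmetry-jump : ∀ m (R : Subset n) → Asymmetry m (false ∷ false ∷ true ∷ true ∷ R)
asymmetry-jump m R =
  asymmetry 2 ≤-refl (true ∷ false ∷ false ∷ true ∷ R) (false ∷ true ∷ true ∷ false ∷ R) (λ ())
    (≼-jump m (true ∷ R)) (≼-false (≼-shift-pair (suc m) R))
    refl (cong (λ x → suc (suc (suc x))) (+-suc m (rankFrom (2 + m) (true ∷ false ∷ R))))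

asymmetry-pair : (R : Subset n) → Asymmetry 0 (false ∷ true ∷ true ∷ R)
asymmetry-pair R =
  asymmetry 2 ≤-refl (false ∷ false ∷ true ∷ R) (true ∷ true ∷ false ∷ R) (λ ())
    (≼-false ≼-delete-first) (≼-shift-pair 0 R) refl refl

-- Shapes of a subset of {m+1, m+2, …} not containing m+1.  Whether {m+2, m+3} ⊆ A is
-- asymmetric depends on what lies below m+1, so that case (pair) is left open.
data ShapeFrom (m : ℕ) : Subset n → Set where
  empty      : ∀ {A : Subset n} → elemsFrom m A ≡ [] → ShapeFrom m A
  singleton  : ∀ {A : Subset n} {x} → elemsFrom m A ≡ [ x ] → ShapeFrom m A
  asymmetric : ∀ {A : Subset n} → Asymmetry m A → ShapeFrom m A
  pair       : (R : Subset n) → ShapeFrom m (false ∷ true ∷ true ∷ R)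

shapeFrom : ∀ m (A : Subset n) → ShapeFrom m (false ∷ A)
shapeFrom m []                  = empty refl
shapeFrom m (true ∷ [])         = singleton refl
shapeFrom m (true ∷ true ∷ R)   = pair R
shapeFrom m (true ∷ false ∷ R) with gap-or-empty (2 + m) R
... | inj₁ g = asymmetric (asymmetry-gap-gap g)
... | inj₂ e = singleton (cong (2 + m ∷_) e)
shapeFrom m (false ∷ A) with shapeFrom (suc m) A
... | empty e      = empty e
... | singleton e  = singleton e
... | asymmetric a = asymmetric (asymmetry-false a)
... | pair R       = asymmetric (asymmetry-jump m R)

EmptySingletonOrSegment : Subset n → Set
EmptySingletonOrSegment {n} A =
  elems A ≡ []
  ⊎ Σ[ k ∈ ℕ ] (1 ≤ k × k ≤ n × elems A ≡ k ∷ [])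
  ⊎ Σ[ k ∈ ℕ ] (1 ≤ k × k ≤ n × elems A ≡ oneTo k)

classify : (A : Subset n) → EmptySingletonOrSegment A ⊎ Asymmetry 0 A
classify []          = inj₁ (inj₁ refl)
classify (true ∷ A)  with gap-or-consecutive 1 A
... | inj₁ g             = inj₂ (asymmetry-true-gap g)
... | inj₂ (q , q≤n , e) =
  inj₁ (inj₂ (inj₂ (suc q , s≤s z≤n , s≤s q≤n , trans (cong (1 ∷_) e) (sym (oneTo≡consecutive (suc q))))))
classify (false ∷ A) with shapeFrom 0 A
... | empty e      = inj₁ (inj₁ e)
... | asymmetric a = inj₂ a
... | pair R       = inj₂ (asymmetry-pair R)
... | singleton {x = x} e with subst (All _) e (elemsFrom-bounded 0 (false ∷ A))
...   | (0<x , x≤n) ∷ [] = inj₁ (inj₂ (inj₁ (x , 0<x , x≤n , e)))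

¬palindromic : (A : Subset n) → Asymmetry 0 A → ¬ Palindromic A
¬palindromic A (asymmetry d d≤2 B₁ B₂ B₁≢B₂ B₁≼A B₂≼A r₁ r₂) palindromic =
  <⇒≱ (≤-trans at-least-two (≤-reflexive (sym (palindromic d d≤rank)))) at-most-one
  where
    d≤rank : d ≤ rank A
    d≤rank = subst (d ≤_) (sym r₁) (m≤m+n d _)
    at-most-one : coeff A d ≤ 1
    at-most-one = countSubsets-≤1 (BelowOfRank? A d)
      (λ (_ , rB) (_ , rC) → rank-injective-≤2 _ _ (trans rB (sym rC)) (subst (_≤ 2) (sym rB) d≤2))
    corank : ∀ {B} → rank A ≡ d + rank B → rank B ≡ rank A ∸ d
    corank r = m+n≡o⇒n≡o∸m (sym r)
    at-least-two : 2 ≤ coeff A (rank A ∸ d)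
    at-least-two = countSubsets-≥2 (BelowOfRank? A (rank A ∸ d))
      (⊑-reversed B₁≼A , corank {B₁} r₁) (⊑-reversed B₂≼A , corank {B₂} r₂) B₁≢B₂

palindromic⇐ : (A : Subset n) → EmptySingletonOrSegment A → Palindromic A
palindromic⇐ A (inj₁ e)                         = palindromic-empty A e
palindromic⇐ A (inj₂ (inj₁ (k , _ , k≤n , e))) = palindromic-singleton A e k≤n
palindromic⇐ A (inj₂ (inj₂ (k , _ , _ , e)))   = palindromic-oneTo A k e

palindromic⇒ : (A : Subset n) → Palindromic A → EmptySingletonOrSegment A
palindromic⇒ A palindromic with classify A
... | inj₁ special = special
... | inj₂ asym    = ⊥-elim (¬palindromic A asym palindromic)

mainTheorem5 : (n : ℕ) → 1 ≤ n → (A : Subset n) →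
    Palindromic A ⇔
    (elems A ≡ []
    ⊎ Σ[ k ∈ ℕ ] (1 ≤ k × k ≤ n × elems A ≡ k ∷ [])
    ⊎ Σ[ k ∈ ℕ ] (1 ≤ k × k ≤ n × elems A ≡ oneTo k))
mainTheorem5 n _ A = mk⇔ (palindromic⇒ A) (palindromic⇐ A)
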